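{- Over the class of all models, $\mathcal{L}_\vartriangleleft$ is more expressive than $\mathcal{L}_O$.
   Context: Models are $\mathcal{M}=\langle W,S,V\rangle$ with $W$ nonempty, $S\subseteq W^3$ an arbitrary ternary relation (written $S_wuv$), $V$ a valuation of proposition symbols. $\mathcal{L}_\vartriangleleft$: $A::=p\mid\neg A\mid A\land A\mid A\vartriangleleft A$, with $\mathcal{M},w\vDash A\vartriangleleft B$ iff for all $u,v$ with $S_wuv$, if $u,v$ agree on the truth of $A$ then they agree on the truth of $B$. $\mathcal{L}_O$: $A::=p\mid\neg A\mid A\land A\mid OA$, with $\mathcal{M},w\vDash OA$ iff for all $u,v$ with $S_wuv$, $u,v$ agree on the truth of $A$. Boolean and atomic clauses as usual. For languages $L1,L2$ interpreted on the same class of models: $L2$ is at least as expressive as $L1$ if every $L1$-formula is equivalent (true at exactly the same pointed models of the class) to some $L2$-formula; $L2$ is more expressive than $L1$ if $L2$ is at least as expressive as $L1$ but not vice versa. -}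

module Defs where

open import Data.Nat using (ℕ)
open import Data.Product using (_×_; Σ)
open import Data.Empty using (⊥)
open import Relation.Nullary using (¬_)
open import Function.Bundles using (_⇔_)
open import Level using (0ℓ; suc)

record Model : Set₁ where
  field
    W    : Set
    inh  : W
    S    : W → W → W → Set         -- S w u v  is  S_w u v
    V    : ℕ → W → Set

open Model public

Agree : {W : Set} → (W → Set) → W → W → Set
Agree T u v = T u ⇔ T v

data Fm◁ : Set where
  var  : ℕ → Fm◁
  ¬◁_  : Fm◁ → Fm◁
  _∧◁_ : Fm◁ → Fm◁ → Fm◁
  _◁_  : Fm◁ → Fm◁ → Fm◁

data FmO : Set where
  var  : ℕ → FmO
  ¬O_  : FmO → FmO
  _∧O_ : FmO → FmO → FmO
  O    : FmO → FmO

_,_⊨◁_ : (M : Model) → W M → Fm◁ → Set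
M , w ⊨◁ var p   = V M p w
M , w ⊨◁ (¬◁ A)  = ¬ (M , w ⊨◁ A)
M , w ⊨◁ (A ∧◁ B) = (M , w ⊨◁ A) × (M , w ⊨◁ B)
M , w ⊨◁ (A ◁ B) = ∀ u v → S M w u v →
  Agree (λ x → M , x ⊨◁ A) u v → Agree (λ x → M , x ⊨◁ B) u v

_,_⊨O_ : (M : Model) → W M → FmO → Set
M , w ⊨O var p    = V M p w
M , w ⊨O (¬O A)   = ¬ (M , w ⊨O A)
M , w ⊨O (A ∧O B) = (M , w ⊨O A) × (M , w ⊨O B)
M , w ⊨O O A      = ∀ u v → S M w u v → Agree (λ x → M , x ⊨O A) u v

_≡◁O_ : Fm◁ → FmO → Set₁
A ≡◁O B = (M : Model) (w : W M) → (M , w ⊨◁ A) ⇔ (M , w ⊨O B)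

◁-atLeast-O : Set₁
◁-atLeast-O = (B : FmO) → Σ Fm◁ (λ A → A ≡◁O B)

O-atLeast-◁ : Set₁
O-atLeast-◁ = (A : Fm◁) → Σ FmO (λ B → A ≡◁O B)

◁-moreExpressive-O : Set₁
◁-moreExpressive-O = ◁-atLeast-O × ¬ O-atLeast-◁

-- O A holds at w exactly when A is constant on every S_w-pair, which is what the tautology ⊤
-- compared against A expresses, so ⊤ ◁ A translates O A. Conversely, O only sees the
-- pairs of S_w through "A is constant on them", and this condition is the same for the pairs
-- {a,b},{a,d} as for {a,d},{b,d}, since either way it says A takes one value on {a,b,d}.
-- The two models with these relations therefore agree on L_O, while p ◁ q, with p true at a
-- and b and q true at a only, holds vacuously in the second model but fails at {a,b} in the first.
module Submission where

open import Defs
open import Data.Nat using (ℕ)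
open import Data.Product using (_,_; proj₁; proj₂)
open import Data.Product.Function.NonDependent.Propositional using (_×-⇔_)
open import Data.Empty using (⊥; ⊥-elim)
open import Data.Unit using (⊤; tt)
open import Relation.Nullary using (¬_)
open import Function.Bundles using (_⇔_; mk⇔; Equivalence)
open import Function.Construct.Identity using (⇔-id)
open import Function.Construct.Symmetry using (⇔-sym)
open import Function.Construct.Composition using () renaming (equivalence to ⇔-trans)
open import Function.Related.TypeIsomorphisms using (¬-cong-⇔)

open Equivalence

Agree-cong : {W : Set} {T T′ : W → Set} → (∀ x → T x ⇔ T′ x) →
             ∀ u v → Agree T u v ⇔ Agree T′ u v
Agree-cong T⇔T′ u v = mk⇔
  (λ Tu⇔Tv → ⇔-trans (⇔-sym (T⇔T′ u)) (⇔-trans Tu⇔Tv (T⇔T′ v)))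
  (λ T′u⇔T′v → ⇔-trans (T⇔T′ u) (⇔-trans T′u⇔T′v (⇔-sym (T⇔T′ v))))

Agree-valid : {W : Set} {T : W → Set} → (∀ x → T x) → ∀ u v → Agree T u v
Agree-valid valid u v = mk⇔ (λ _ → valid v) (λ _ → valid u)

⊤◁ : Fm◁
⊤◁ = ¬◁ (var 0 ∧◁ (¬◁ var 0))

⊤◁-valid : (M : Model) (x : W M) → M , x ⊨◁ ⊤◁
⊤◁-valid M x (p , ¬p) = ¬p p

O→◁ : FmO → Fm◁
O→◁ (var p)  = var p
O→◁ (¬O A)   = ¬◁ O→◁ A
O→◁ (A ∧O B) = O→◁ A ∧◁ O→◁ B
O→◁ (O A)    = ⊤◁ ◁ O→◁ A

O→◁-correct : (A : FmO) → O→◁ A ≡◁O A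
O→◁-correct (var p)  M x = ⇔-id _
O→◁-correct (¬O A)   M x = ¬-cong-⇔ (O→◁-correct A M x)
O→◁-correct (A ∧O B) M x = O→◁-correct A M x ×-⇔ O→◁-correct B M x
O→◁-correct (O A)    M x = mk⇔
  (λ ⊤◁A u v Sxuv → to (A-agree u v) (⊤◁A u v Sxuv (Agree-valid (⊤◁-valid M) u v)))
  (λ OA u v Sxuv _ → from (A-agree u v) (OA u v Sxuv))
  where A-agree = Agree-cong (λ y → O→◁-correct A M y)

-- With T the truth set of A, Uniform (S M) x T is definitionally M , x ⊨O O A.
Uniform : {W : Set} → (W → W → W → Set) → W → (W → Set) → Set
Uniform S x T = ∀ u v → S x u v → Agree T u v

infixl 30 _[S≔_]

_[S≔_] : (M : Model) → (W M → W M → W M → Set) → Model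
M [S≔ S′ ] = record M { S = S′ }

O-invariant : (M : Model) (S′ : W M → W M → W M → Set) →
              (∀ x T → Uniform (S M) x T ⇔ Uniform S′ x T) →
              (A : FmO) (x : W M) → (M , x ⊨O A) ⇔ (M [S≔ S′ ] , x ⊨O A)
O-invariant M S′ S≈S′ (var p)  x = ⇔-id _
O-invariant M S′ S≈S′ (¬O A)   x = ¬-cong-⇔ (O-invariant M S′ S≈S′ A x)
O-invariant M S′ S≈S′ (A ∧O B) x =
  O-invariant M S′ S≈S′ A x ×-⇔ O-invariant M S′ S≈S′ B x
O-invariant M S′ S≈S′ (O A)    x = mk⇔
  (λ OA u v S′xuv → to (A-agree u v) (to (S≈S′ x _) OA u v S′xuv))
  (λ OA → from (S≈S′ x _) (λ u v S′xuv → from (A-agree u v) (OA u v S′xuv)))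
  where A-agree = Agree-cong (O-invariant M S′ S≈S′ A)

separated⇒¬O-atLeast-◁ : (M N : Model) (x : W M) (y : W N) →
                          (∀ B → (M , x ⊨O B) ⇔ (N , y ⊨O B)) →
                          (A : Fm◁) → M , x ⊨◁ A → ¬ (N , y ⊨◁ A) → ¬ O-atLeast-◁
separated⇒¬O-atLeast-◁ M N x y O-equiv A M⊨A N⊭A express =
  N⊭A (from (A≡B N y) (to (O-equiv B) (to (A≡B M x) M⊨A)))
  where
  B   = proj₁ (express A)
  A≡B = proj₂ (express A)

data Point : Set where
  w a b d : Point

Val : ℕ → Point → Set
Val 0 a = ⊤
Val 0 b = ⊤
Val 1 a = ⊤
Val _ _ = ⊥

data S-ab-ad : Point → Point → Point → Set where
  ab : S-ab-ad w a b
  ad : S-ab-ad w a d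

data S-ad-bd : Point → Point → Point → Set where
  ad : S-ad-bd w a d
  bd : S-ad-bd w b d

S-ab-ad≈S-ad-bd : ∀ x T → Uniform S-ab-ad x T ⇔ Uniform S-ad-bd x T
S-ab-ad≈S-ad-bd x T = mk⇔ ab,ad⇒ad,bd ad,bd⇒ab,ad
  where
  ab,ad⇒ad,bd : Uniform S-ab-ad x T → Uniform S-ad-bd x T
  ab,ad⇒ad,bd U .a .d ad = U a d ad
  ab,ad⇒ad,bd U .b .d bd = ⇔-trans (⇔-sym (U a b ab)) (U a d ad)

  ad,bd⇒ab,ad : Uniform S-ad-bd x T → Uniform S-ab-ad x T
  ad,bd⇒ab,ad U .a .b ab = ⇔-trans (U a d ad) (⇔-sym (U b d bd))
  ad,bd⇒ab,ad U .a .d ad = U a d ad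

M₁ M₂ : Model
M₁ = record { W = Point ; inh = w ; S = S-ab-ad ; V = Val }
M₂ = M₁ [S≔ S-ad-bd ]

p◁q : Fm◁
p◁q = var 0 ◁ var 1

M₂⊨p◁q : M₂ , w ⊨◁ p◁q
M₂⊨p◁q .a .d ad p-agrees = ⊥-elim (to p-agrees tt)
M₂⊨p◁q .b .d bd p-agrees = ⊥-elim (to p-agrees tt)

M₁⊭p◁q : ¬ (M₁ , w ⊨◁ p◁q)
M₁⊭p◁q p◁q-holds = to (p◁q-holds a b ab (mk⇔ (λ _ → tt) (λ _ → tt))) tt

proposition4p4 : ◁-moreExpressive-O
proposition4p4 =
    (λ A → O→◁ A , O→◁-correct A)
  , separated⇒¬O-atLeast-◁ M₂ M₁ w w
      (λ B → ⇔-sym (O-invariant M₁ S-ad-bd S-ab-ad≈S-ad-bd B w))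
      p◁q M₂⊨p◁q M₁⊭p◁q
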